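{- Let $\mathcal D$ be any strongly first order dependency. Then $\mathcal D^{\downarrow}$ is also strongly first order; and if $\mathcal D$ is relativizable then so is $\mathcal D^{\downarrow}$.
   Context: Team Semantics: all first-order models have domains with at least two elements; first-order formulas are in negation normal form. A team $X$ over a model $\mathfrak M$ with domain $M$ is a set of assignments $s:V\to M$ for a fixed finite set of variables $V$; $X(\bar v)=\{s(\bar v):s\in X\}$. Satisfaction $\mathfrak M\models_X\phi$: for a first-order literal $\alpha$, iff $\mathfrak M\models_s\alpha$ for all $s\in X$; $\phi_1\vee\phi_2$ iff $X=Y\cup Z$ with $\mathfrak M\models_Y\phi_1$, $\mathfrak M\models_Z\phi_2$; $\phi_1\wedge\phi_2$ iff both hold; $\exists v\psi$ iff there is $H:X\to\mathcal P(M)\setminus\{\emptyset\}$ with $\mathfrak M\models_{X[H/v]}\psi$, $X[H/v]=\{s[m/v]:s\in X,m\in H(s)\}$; $\forall v\psi$ iff $\mathfrak M\models_{X[M/v]}\psi$, $X[M/v]=\{s[m/v]:s\in X,m\in M\}$. A sentence is true in $\mathfrak M$ iff satisfied by $\{\emptyset\}$. A $k$-ary generalized dependency is a class $\mathcal D$ of structures $(M,R)$, $R\subseteq M^k$, closed under isomorphism; the atom $\mathcal D\bar x$ is satisfied by $X$ iff $(M,X(\bar x))\in\mathcal D$. $\mathcal D$ is strongly first order if every sentence of $\mathrm{FO}(\mathcal D)$ (first-order logic with Team Semantics plus this atom) is equivalent to a first-order sentence. For a unary predicate $P$, $\mathfrak M\models_X\mathcal D^{(P)}\bar x$ iff $(P^{\mathfrak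 M},X(\bar x))\in\mathcal D$; $\mathcal D$ is relativizable if every sentence of $\mathrm{FO}(\mathcal D^{(P)})$ is equivalent to a sentence of $\mathrm{FO}(\mathcal D)$. The downwards closure is $\mathcal D^{\downarrow}=\{(M,R):\exists R'\supseteq R\text{ with }(M,R')\in\mathcal D\}$. -}

module Defs where

open import Level using (Level; 0ℓ; Lift) renaming (suc to lsuc)
open import Data.Nat using (ℕ; zero; suc)
open import Data.Bool using (Bool; true; false)
open import Data.Fin using (Fin)
open import Data.Vec using (Vec; []; _∷_; map; lookup; head; tail; replicate)
open import Data.Product using (Σ; ∃; _×_; _,_; proj₁; proj₂)
open import Data.Sum using (_⊎_)
open import Data.Unit using (⊤)
open import Data.Empty using (⊥)
open import Relation.Binary.PropositionalEquality using (_≡_; _≢_)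
open import Function.Bundles using (_↔_; Inverse)

record Signature : Set₁ where
  field
    Fun    : Set
    funAr  : Fun → ℕ
    Pred   : Set
    predAr : Pred → ℕ

open Signature public

record Structure (L : Signature) : Set₁ where
  field
    Dom   : Set
    fun   : (f : Fun L) → Vec Dom (funAr L f) → Dom
    rel   : (R : Pred L) → Vec Dom (predAr L R) → Bool
    a₀ a₁ : Dom
    a₀≢a₁ : a₀ ≢ a₁

open Structure public

-- Terms and formulas (negation normal form). Variables are de Bruijn
-- indices: a formula with n free variables has type Formula L A n,
-- an assignment is a vector in Dom^n, and the quantified variable of
-- ex/all is index zero (head of the assignment vector).
-- A n : the non-first-order atoms available with n variables.

data Term (L : Signature) (n : ℕ) : Set where
  var : Fin n → Term L n
  app : (f : Fun L) → Vec (Term L n) (funAr L f) → Term L n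

data Formula (L : Signature) (A : ℕ → Set) (n : ℕ) : Set where
  eq neq    : Term L n → Term L n → Formula L A n
  relAt nrelAt : (R : Pred L) → Vec (Term L n) (predAr L R) → Formula L A n
  atom      : A n → Formula L A n
  and or    : Formula L A n → Formula L A n → Formula L A n
  ex all    : Formula L A (suc n) → Formula L A n

NoAtom : ℕ → Set
NoAtom _ = ⊥

DepAtom : ℕ → ℕ → Set
DepAtom k n = Vec (Fin n) k

Sentence : (L : Signature) (A : ℕ → Set) → Set
Sentence L A = Formula L A 0

module _ {L : Signature} (𝔐 : Structure L) where
  mutual
    eval : ∀ {n} → Vec (Dom 𝔐) n → Term L n → Dom 𝔐
    eval s (var i)    = lookup s i
    eval s (app f ts) = fun 𝔐 f (evalVec s ts)

    evalVec : ∀ {n k} → Vec (Dom 𝔐) n → Vec (Term L n) k → Vec (Dom 𝔐) k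
    evalVec s []       = []
    evalVec s (t ∷ ts) = eval s t ∷ evalVec s ts

Team : Set → ℕ → Set₁
Team M n = Vec M n → Set

teamRel : ∀ {M n k} → Team M n → Vec (Fin n) k → Vec M k → Set
teamRel {M} {n} X xs t = Σ (Vec M n) λ s → X s × (map (lookup s) xs ≡ t)

AtomSem : Signature → (ℕ → Set) → Set₂
AtomSem L A = (𝔐 : Structure L) → ∀ {n} → A n → Team (Dom 𝔐) n → Set₁

noSem : ∀ {L} → AtomSem L NoAtom
noSem 𝔐 ()

module _ {L : Signature} {A : ℕ → Set} (𝔐 : Structure L) (asem : AtomSem L A) where
  private M = Dom 𝔐

  sat : ∀ {n} → Team M n → Formula L A n → Set₁
  sat X (eq t u)    = Lift (lsuc 0ℓ) (∀ s → X s → eval 𝔐 s t ≡ eval 𝔐 s u)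
  sat X (neq t u)   = Lift (lsuc 0ℓ) (∀ s → X s → eval 𝔐 s t ≢ eval 𝔐 s u)
  sat X (relAt R ts)  = Lift (lsuc 0ℓ) (∀ s → X s → rel 𝔐 R (evalVec 𝔐 s ts) ≡ true)
  sat X (nrelAt R ts) = Lift (lsuc 0ℓ) (∀ s → X s → rel 𝔐 R (evalVec 𝔐 s ts) ≡ false)
  sat X (atom a)    = asem 𝔐 a X
  sat X (and φ ψ)   = sat X φ × sat X ψ
  sat {n} X (or φ ψ) =
    Σ (Team M n) λ Y → Σ (Team M n) λ Z →
      Lift (lsuc 0ℓ) ((∀ s → X s → Y s ⊎ Z s) × (∀ s → Y s → X s) × (∀ s → Z s → X s))
      × sat Y φ × sat Z ψ
  -- H(s) ⊆ M, required nonempty for every s ∈ X;  X[H/v] = {s[m/v] : s ∈ X, m ∈ H(s)}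
  sat {n} X (ex φ)  =
    Σ (Vec M n → M → Set) λ H →
      Lift (lsuc 0ℓ) (∀ s → X s → ∃ λ m → H s m)
      × sat (λ t → X (tail t) × H (tail t) (head t)) φ
  sat X (all φ)     = sat (λ t → X (tail t)) φ

  -- truth of a sentence: satisfied by the team {∅}
  True : Sentence L A → Set₁
  True φ = sat (λ _ → ⊤) φ

Dep : ℕ → Set₂
Dep k = (M : Set) → (Vec M k → Set) → Set₁

IsoClosed : ∀ {k} → Dep k → Set₁
IsoClosed {k} D =
  ∀ {M N : Set} (f : M ↔ N) (R : Vec M k → Set) (S : Vec N k → Set) →
  (∀ w → S w → R (map (Inverse.from f) w)) →
  (∀ w → R (map (Inverse.from f) w) → S w) →
  D M R → D N S

_↓ : ∀ {k} → Dep k → Dep k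
(D ↓) M R = Σ (_ → Set) λ R' → Lift (lsuc 0ℓ) (∀ v → R v → R' v) × D M R'

depSem : ∀ {L k} → Dep k → AtomSem L (DepAtom k)
depSem D 𝔐 xs X = D (Dom 𝔐) (teamRel X xs)

PSet : ∀ {L} → Structure L → Pred L → Set
PSet 𝔐 P = Σ (Dom 𝔐) λ a → rel 𝔐 P (replicate _ a) ≡ true

relSem : ∀ {L k} → Dep k → Pred L → AtomSem L (DepAtom k)
relSem {L} {k} D P 𝔐 {n} xs X =
  Lift (lsuc 0ℓ) (∀ s → X s → ∀ i → rel 𝔐 P (replicate _ (lookup s (lookup xs i))) ≡ true)
  × D (PSet 𝔐 P) (λ w → teamRel X xs (map proj₁ w))

_⇔₁_ : Set₁ → Set₁ → Set₁
P ⇔₁ Q = (P → Q) × (Q → P)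

StronglyFirstOrder : ∀ {k} → Dep k → Set₁
StronglyFirstOrder {k} D =
  ∀ (L : Signature) (φ : Sentence L (DepAtom k)) →
  Σ (Sentence L NoAtom) λ ψ →
    ∀ (𝔐 : Structure L) → True 𝔐 (depSem D) φ ⇔₁ True 𝔐 noSem ψ

Relativizable : ∀ {k} → Dep k → Set₁
Relativizable {k} D =
  ∀ (L : Signature) (P : Pred L) → predAr L P ≡ 1 →
  (φ : Sentence L (DepAtom k)) →
  Σ (Sentence L (DepAtom k)) λ ψ →
    ∀ (𝔐 : Structure L) → True 𝔐 (relSem D P) φ ⇔₁ True 𝔐 (depSem D) ψ

{-# OPTIONS --safe #-}

-- On a nonempty team, D↓ x̄ is equivalent to the FO(D) formula θ(x̄) = ∀ȳ (ȳ ≠ x̄ ∨ D ȳ): the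
-- part of the team where ȳ = x̄ yields a superset of X(x̄) in D, and conversely a superset R
-- in D can be realised as the ȳ-values of that part. On the empty team, D↓ x̄ holds iff D
-- contains some relation on the domain, i.e. iff the FO(D) sentence γ = ∀ȳ (D ȳ ∨ ⊤) is true.
-- Since emptiness of the team reaching an atom is not expressible, a sentence φ of FO(D↓) is
-- translated as  φ[θ] ∨ (γ ∧ ⋁ φ[θ or ⊥]),  the disjunction ranging over all ways of replacing
-- each atom occurrence by θ or by ⊥ (when γ fails no atom holds on an empty team, so φ[θ]
-- suffices); every disjunct is an FO(D) sentence, hence first-order.
-- Relativized to P, θ becomes P x̄ ∧ ∀ȳ (ȳ ≠ x̄ ∨ ¬P ȳ ∨ D^(P) ȳ), and the same translation
-- takes FO(D↓^(P)) to FO(D^(P)), thence to FO(D), to FO, and so into FO(D↓).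

module Submission where

open import Defs
open import Axiom.ExcludedMiddle using (ExcludedMiddle)
open import Axiom.UniquenessOfIdentityProofs using (module Decidable⇒UIP)
open import Level using (lift)
open import Data.Nat using (ℕ; zero; suc; _+_)
open import Data.Bool using (true; false)
open import Data.Bool.Properties using (_≟_; ¬-not; not-¬)
open import Data.Fin using (Fin; zero; suc; _↑ʳ_)
open import Data.Vec using (Vec; []; _∷_; map; lookup; head; tail; replicate; _++_)
open import Data.Vec.Properties using (lookup-map; map-id; map-∘; map-cong)
open import Data.List using (List; []; _∷_; cartesianProductWith) renaming (map to mapᴸ)
open import Data.List.Membership.Propositional using (_∈_; find; lose)
open import Data.List.Membership.Propositional.Properties
  using (∈-map⁺; ∈-map⁻; ∈-cartesianProductWith⁺; ∈-cartesianProductWith⁻)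
open import Data.List.Relation.Unary.Any using (Any; here; there)
open import Data.Product using (Σ; ∃; _×_; _,_; proj₁; proj₂)
open import Data.Sum using (_⊎_; inj₁; inj₂)
open import Data.Unit using (⊤; tt)
open import Data.Empty using (⊥-elim)
open import Function.Base using (id; _∘_)
open import Function.Properties.Inverse using (↔-refl)
open import Relation.Nullary using (¬_; yes; no)
open import Relation.Binary.PropositionalEquality

module _ {L : Signature} (𝔐 : Structure L) where

  Holds : ∀ {n} → Vec (Dom 𝔐) n → Formula L NoAtom n → Set
  Holds s (eq t u)      = eval 𝔐 s t ≡ eval 𝔐 s u
  Holds s (neq t u)     = eval 𝔐 s t ≢ eval 𝔐 s u
  Holds s (relAt R ts)  = rel 𝔐 R (evalVec 𝔐 s ts) ≡ true
  Holds s (nrelAt R ts) = rel 𝔐 R (evalVec 𝔐 s ts) ≡ false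
  Holds s (atom ())
  Holds s (and φ ψ)     = Holds s φ × Holds s ψ
  Holds s (or φ ψ)      = Holds s φ ⊎ Holds s ψ
  Holds s (ex φ)        = ∃ λ m → Holds (m ∷ s) φ
  Holds s (all φ)       = ∀ m → Holds (m ∷ s) φ

fromFO : ∀ {L A n} → Formula L NoAtom n → Formula L A n
fromFO (eq t u)      = eq t u
fromFO (neq t u)     = neq t u
fromFO (relAt R ts)  = relAt R ts
fromFO (nrelAt R ts) = nrelAt R ts
fromFO (atom ())
fromFO (and φ ψ)     = and (fromFO φ) (fromFO ψ)
fromFO (or φ ψ)      = or (fromFO φ) (fromFO ψ)
fromFO (ex φ)        = ex (fromFO φ)
fromFO (all φ)       = all (fromFO φ)

fromFO-NoAtom : ∀ {L n} (φ : Formula L NoAtom n) → fromFO φ ≡ φ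
fromFO-NoAtom (eq t u)      = refl
fromFO-NoAtom (neq t u)     = refl
fromFO-NoAtom (relAt R ts)  = refl
fromFO-NoAtom (nrelAt R ts) = refl
fromFO-NoAtom (atom ())
fromFO-NoAtom (and φ ψ)     = cong₂ and (fromFO-NoAtom φ) (fromFO-NoAtom ψ)
fromFO-NoAtom (or φ ψ)      = cong₂ or (fromFO-NoAtom φ) (fromFO-NoAtom ψ)
fromFO-NoAtom (ex φ)        = cong ex (fromFO-NoAtom φ)
fromFO-NoAtom (all φ)       = cong all (fromFO-NoAtom φ)

module _ {L : Signature} {A : ℕ → Set} (𝔐 : Structure L) (S : AtomSem L A) where
  private M = Dom 𝔐

  sat-fromFO⁻ : ∀ {n} (φ : Formula L NoAtom n) (X : Team M n) →
                sat 𝔐 S X (fromFO φ) → ∀ s → X s → Holds 𝔐 s φ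
  sat-fromFO⁻ (eq t u)      X (lift p) = p
  sat-fromFO⁻ (neq t u)     X (lift p) = p
  sat-fromFO⁻ (relAt R ts)  X (lift p) = p
  sat-fromFO⁻ (nrelAt R ts) X (lift p) = p
  sat-fromFO⁻ (atom ())
  sat-fromFO⁻ (and φ ψ) X (p , q) s x = sat-fromFO⁻ φ X p s x , sat-fromFO⁻ ψ X q s x
  sat-fromFO⁻ (or φ ψ) X (Y , Z , lift (cover , _ , _) , p , q) s x with cover s x
  ... | inj₁ y = inj₁ (sat-fromFO⁻ φ Y p s y)
  ... | inj₂ z = inj₂ (sat-fromFO⁻ ψ Z q s z)
  sat-fromFO⁻ (ex φ) X (H , lift H-nonempty , p) s x =
    let m , h = H-nonempty s x in m , sat-fromFO⁻ φ _ p (m ∷ s) (x , h)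
  sat-fromFO⁻ (all φ) X p s x m = sat-fromFO⁻ φ _ p (m ∷ s) x

  sat-fromFO⁺ : ∀ {n} (φ : Formula L NoAtom n) (X : Team M n) →
                (∀ s → X s → Holds 𝔐 s φ) → sat 𝔐 S X (fromFO φ)
  sat-fromFO⁺ (eq t u)      X p = lift p
  sat-fromFO⁺ (neq t u)     X p = lift p
  sat-fromFO⁺ (relAt R ts)  X p = lift p
  sat-fromFO⁺ (nrelAt R ts) X p = lift p
  sat-fromFO⁺ (atom ())
  sat-fromFO⁺ (and φ ψ) X p =
    sat-fromFO⁺ φ X (λ s → proj₁ ∘ p s) , sat-fromFO⁺ ψ X (λ s → proj₂ ∘ p s)
  sat-fromFO⁺ (or φ ψ) X p =
    (λ s → X s × Holds 𝔐 s φ) , (λ s → X s × Holds 𝔐 s ψ) ,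
    lift (cover , (λ _ → proj₁) , (λ _ → proj₁)) ,
    sat-fromFO⁺ φ _ (λ _ → proj₂) , sat-fromFO⁺ ψ _ (λ _ → proj₂)
    where
    cover : ∀ s → X s → (X s × Holds 𝔐 s φ) ⊎ (X s × Holds 𝔐 s ψ)
    cover s x with p s x
    ... | inj₁ h = inj₁ (x , h)
    ... | inj₂ h = inj₂ (x , h)
  sat-fromFO⁺ (ex φ) X p = (λ s m → Holds 𝔐 (m ∷ s) φ) , lift p , sat-fromFO⁺ φ _ witness
    where
    witness : ∀ t → X (tail t) × Holds 𝔐 (head t ∷ tail t) φ → Holds 𝔐 t φ
    witness (m ∷ s) (_ , h) = h
  sat-fromFO⁺ (all φ) X p = sat-fromFO⁺ φ _ extended
    where
    extended : ∀ t → X (tail t) → Holds 𝔐 t φ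
    extended (m ∷ s) x = p s x m

  True-fromFO⁻ : (φ : Sentence L NoAtom) → True 𝔐 S (fromFO φ) → Holds 𝔐 [] φ
  True-fromFO⁻ φ p = sat-fromFO⁻ φ _ p [] tt

  True-fromFO⁺ : (φ : Sentence L NoAtom) → Holds 𝔐 [] φ → True 𝔐 S (fromFO φ)
  True-fromFO⁺ φ p = sat-fromFO⁺ φ _ λ { [] _ → p }

module _ {L : Signature} (𝔐 : Structure L) where

  True-noSem⁻ : (φ : Sentence L NoAtom) → True 𝔐 noSem φ → Holds 𝔐 [] φ
  True-noSem⁻ φ = True-fromFO⁻ 𝔐 noSem φ ∘ subst (True 𝔐 noSem) (sym (fromFO-NoAtom φ))

  True-noSem⁺ : (φ : Sentence L NoAtom) → Holds 𝔐 [] φ → True 𝔐 noSem φ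
  True-noSem⁺ φ = subst (True 𝔐 noSem) (fromFO-NoAtom φ) ∘ True-fromFO⁺ 𝔐 noSem φ

falsum verum : ∀ {L n} → Formula L NoAtom n
falsum = all (neq (var zero) (var zero))
verum  = all (eq (var zero) (var zero))

⋁ : ∀ {L n} {C : Set} → (C → Formula L NoAtom n) → List C → Formula L NoAtom n
⋁ f []       = falsum
⋁ f (c ∷ cs) = or (f c) (⋁ f cs)

differ : ∀ {L m j} → Vec (Fin m) j → Vec (Fin m) j → Formula L NoAtom m
differ []       []       = falsum
differ (a ∷ as) (b ∷ bs) = or (neq (var a) (var b)) (differ as bs)

allIn : ∀ {L m j} → Pred L → Vec (Fin m) j → Formula L NoAtom m
allIn P []       = verum
allIn P (a ∷ as) = and (relAt P (replicate _ (var a))) (allIn P as)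

someOutside : ∀ {L m j} → Pred L → Vec (Fin m) j → Formula L NoAtom m
someOutside P []       = falsum
someOutside P (a ∷ as) = or (nrelAt P (replicate _ (var a))) (someOutside P as)

InP : ∀ {L} (𝔐 : Structure L) → Pred L → Dom 𝔐 → Set
InP 𝔐 P a = rel 𝔐 P (replicate _ a) ≡ true

AllInP : ∀ {L} (𝔐 : Structure L) → Pred L → ∀ {j} → Vec (Dom 𝔐) j → Set
AllInP 𝔐 P v = ∀ i → InP 𝔐 P (lookup v i)

module _ {L : Signature} (𝔐 : Structure L) where
  private M = Dom 𝔐

  ¬Holds-falsum : ∀ {n} (s : Vec M n) → ¬ Holds 𝔐 s falsum
  ¬Holds-falsum s p = p (a₀ 𝔐) refl

  Holds-verum : ∀ {n} (s : Vec M n) → Holds 𝔐 s verum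
  Holds-verum s m = refl

  Holds-⋁⁻ : ∀ {n} {C : Set} (f : C → Formula L NoAtom n) (s : Vec M n) cs →
             Holds 𝔐 s (⋁ f cs) → Any (λ c → Holds 𝔐 s (f c)) cs
  Holds-⋁⁻ f s []       p        = ⊥-elim (¬Holds-falsum s p)
  Holds-⋁⁻ f s (c ∷ cs) (inj₁ p) = here p
  Holds-⋁⁻ f s (c ∷ cs) (inj₂ p) = there (Holds-⋁⁻ f s cs p)

  Holds-⋁⁺ : ∀ {n} {C : Set} (f : C → Formula L NoAtom n) (s : Vec M n) {cs} →
             Any (λ c → Holds 𝔐 s (f c)) cs → Holds 𝔐 s (⋁ f cs)
  Holds-⋁⁺ f s (here p)  = inj₁ p
  Holds-⋁⁺ f s (there p) = inj₂ (Holds-⋁⁺ f s p)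

  Holds-differ⁻ : ∀ {m j} (s : Vec M m) (as bs : Vec (Fin m) j) →
                  Holds 𝔐 s (differ as bs) → map (lookup s) as ≢ map (lookup s) bs
  Holds-differ⁻ s []       []       p        _ = ¬Holds-falsum s p
  Holds-differ⁻ s (a ∷ as) (b ∷ bs) (inj₁ p) e = p (cong head e)
  Holds-differ⁻ s (a ∷ as) (b ∷ bs) (inj₂ p) e = Holds-differ⁻ s as bs p (cong tail e)

  Holds-differ⁺ : (∀ {ℓ} → ExcludedMiddle ℓ) → ∀ {m j} (s : Vec M m) (as bs : Vec (Fin m) j) →
                  map (lookup s) as ≢ map (lookup s) bs → Holds 𝔐 s (differ as bs)
  Holds-differ⁺ em s []       []       ne = ⊥-elim (ne refl)
  Holds-differ⁺ em s (a ∷ as) (b ∷ bs) ne with em {P = lookup s a ≡ lookup s b}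
  ... | no  a≢b = inj₁ a≢b
  ... | yes a≡b = inj₂ (Holds-differ⁺ em s as bs (ne ∘ cong₂ _∷_ a≡b))

  evalVec-replicate : ∀ {n} m (s : Vec M n) (a : Fin n) →
                      evalVec 𝔐 s (replicate m (var a)) ≡ replicate m (lookup s a)
  evalVec-replicate zero    s a = refl
  evalVec-replicate (suc m) s a = cong (lookup s a ∷_) (evalVec-replicate m s a)

  rel-replicate-var : ∀ {n} (P : Pred L) (s : Vec M n) (a : Fin n) →
                      rel 𝔐 P (evalVec 𝔐 s (replicate _ (var a))) ≡ rel 𝔐 P (replicate _ (lookup s a))
  rel-replicate-var P s a = cong (rel 𝔐 P) (evalVec-replicate _ s a)

  Holds-allIn⁻ : ∀ {m j} (P : Pred L) (s : Vec M m) (as : Vec (Fin m) j) →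
                 Holds 𝔐 s (allIn P as) → ∀ i → InP 𝔐 P (lookup s (lookup as i))
  Holds-allIn⁻ P s (a ∷ as) (p , _) zero    = trans (sym (rel-replicate-var P s a)) p
  Holds-allIn⁻ P s (a ∷ as) (_ , q) (suc i) = Holds-allIn⁻ P s as q i

  Holds-allIn⁺ : ∀ {m j} (P : Pred L) (s : Vec M m) (as : Vec (Fin m) j) →
                 (∀ i → InP 𝔐 P (lookup s (lookup as i))) → Holds 𝔐 s (allIn P as)
  Holds-allIn⁺ P s []       p = Holds-verum s
  Holds-allIn⁺ P s (a ∷ as) p =
    trans (rel-replicate-var P s a) (p zero) , Holds-allIn⁺ P s as (p ∘ suc)

  Holds-someOutside⁻ : ∀ {m j} (P : Pred L) (s : Vec M m) (as : Vec (Fin m) j) →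
                       Holds 𝔐 s (someOutside P as) → ¬ AllInP 𝔐 P (map (lookup s) as)
  Holds-someOutside⁻ P s []       p        _  = ¬Holds-falsum s p
  Holds-someOutside⁻ P s (a ∷ as) (inj₁ p) ∈P = not-¬ (∈P zero) (trans (sym (rel-replicate-var P s a)) p)
  Holds-someOutside⁻ P s (a ∷ as) (inj₂ p) ∈P = Holds-someOutside⁻ P s as p (∈P ∘ suc)

  Holds-someOutside⁺ : (∀ {ℓ} → ExcludedMiddle ℓ) → ∀ {m j} (P : Pred L) (s : Vec M m) (as : Vec (Fin m) j) →
                       ¬ AllInP 𝔐 P (map (lookup s) as) → Holds 𝔐 s (someOutside P as)
  Holds-someOutside⁺ em P s []       out = ⊥-elim (out λ ())
  Holds-someOutside⁺ em P s (a ∷ as) out with em {P = InP 𝔐 P (lookup s a)}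
  ... | no  a∉P = inj₁ (trans (rel-replicate-var P s a) (¬-not a∉P))
  ... | yes a∈P = inj₂ (Holds-someOutside⁺ em P s as λ as∈P →
                    out λ { zero → a∈P ; (suc i) → as∈P i })

dropFirst : ∀ {M : Set} k {n} → Vec M (k + n) → Vec M n
dropFirst zero    t = t
dropFirst (suc k) t = dropFirst k (tail t)

firstVars : ∀ k n → Vec (Fin (k + n)) k
firstVars zero    n = []
firstVars (suc k) n = zero ∷ map suc (firstVars k n)

-- ∀ȳ for ȳ the de Bruijn indices 0 … k−1; the variables of the body move up by k (k ↑ʳ_)
allFirst : ∀ {L A} k {n} → Formula L A (k + n) → Formula L A n
allFirst zero    φ = φ
allFirst (suc k) φ = allFirst k (all φ)

module _ {M : Set} where

  dropFirst-++ : ∀ {k n} (v : Vec M k) (s : Vec M n) → dropFirst k (v ++ s) ≡ s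
  dropFirst-++ []      s = refl
  dropFirst-++ (a ∷ v) s = dropFirst-++ v s

  map-lookup-firstVars : ∀ {k n} (v : Vec M k) (s : Vec M n) →
                         map (lookup (v ++ s)) (firstVars k n) ≡ v
  map-lookup-firstVars []      s = refl
  map-lookup-firstVars (a ∷ v) s =
    cong (a ∷_) (trans (sym (map-∘ (lookup (a ∷ v ++ s)) suc (firstVars _ _)))
                       (map-lookup-firstVars v s))

  lookup-↑ʳ : ∀ k {n} (t : Vec M (k + n)) (j : Fin n) → lookup t (k ↑ʳ j) ≡ lookup (dropFirst k t) j
  lookup-↑ʳ zero    t       j = refl
  lookup-↑ʳ (suc k) (a ∷ t) j = lookup-↑ʳ k t j

  map-lookup-↑ʳ : ∀ k {n j} (t : Vec M (k + n)) (xs : Vec (Fin n) j) →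
                  map (lookup t) (map (k ↑ʳ_) xs) ≡ map (lookup (dropFirst k t)) xs
  map-lookup-↑ʳ k t xs = trans (sym (map-∘ (lookup t) (k ↑ʳ_) xs)) (map-cong (lookup-↑ʳ k t) xs)

sat-allFirst : ∀ {L A} (𝔐 : Structure L) (S : AtomSem L A) k {n}
               (X : Team (Dom 𝔐) n) (φ : Formula L A (k + n)) →
               sat 𝔐 S X (allFirst k φ) ≡ sat 𝔐 S (λ t → X (dropFirst k t)) φ
sat-allFirst 𝔐 S zero    X φ = refl
sat-allFirst 𝔐 S (suc k) X φ = sat-allFirst 𝔐 S k X (all φ)

module Fresh {M : Set} (k : ℕ) where

  fresh : ∀ {n} → Vec M (k + n) → Vec M k
  fresh t = map (lookup t) (firstVars k _)

  -- the tuple ȳ := x̄ ∈ X(x̄) lands in Y, because on Z the tuples ȳ and x̄ differ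
  teamRel-split : ∀ {n} {X : Team M n} {Y Z : Team M (k + n)} (xs : Vec (Fin n) k) (Q : Vec M k → Set) →
            (∀ t → X (dropFirst k t) → Z t ⊎ Y t) →
            (∀ t → Z t → Q (fresh t) → fresh t ≢ map (lookup t) (map (k ↑ʳ_) xs)) →
            ∀ v → Q v → teamRel X xs v → teamRel Y (firstVars k n) v
  teamRel-split {X = X} xs Q cover separated v q (s , x , refl) with cover (v ++ s) (subst X (sym (dropFirst-++ v s)) x)
  ... | inj₂ y = v ++ s , y , map-lookup-firstVars v s
  ... | inj₁ z = ⊥-elim (separated (v ++ s) z (subst Q (sym fresh≡v) q) (begin
          fresh (v ++ s)                                 ≡⟨ fresh≡v ⟩
          map (lookup s) xs                              ≡⟨ cong (λ u → map (lookup u) xs) (dropFirst-++ v s) ⟨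
          map (lookup (dropFirst k (v ++ s))) xs         ≡⟨ map-lookup-↑ʳ k (v ++ s) xs ⟨
          map (lookup (v ++ s)) (map (k ↑ʳ_) xs)         ∎))
    where
    open ≡-Reasoning
    fresh≡v = map-lookup-firstVars v s

  teamRel-dropFirst : ∀ {n} (X : Team M n) (xs : Vec (Fin n) k) (t : Vec M (k + n)) →
                      X (dropFirst k t) → teamRel X xs (map (lookup t) (map (k ↑ʳ_) xs))
  teamRel-dropFirst X xs t x = dropFirst k t , x , sym (map-lookup-↑ʳ k t xs)

  teamRel-restrict⁻ : ∀ {n} (B : Team M (k + n)) (R : Vec M k → Set) {v} →
                      teamRel (λ t → B t × R (fresh t)) (firstVars k n) v → R v
  teamRel-restrict⁻ B R (t , (_ , r) , refl) = r

  teamRel-restrict⁺ : ∀ {n} (B : Team M (k + n)) (R : Vec M k → Set) (s₀ : Vec M n) →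
                      (∀ v → B (v ++ s₀)) →
                      ∀ {v} → R v → teamRel (λ t → B t × R (fresh t)) (firstVars k n) v
  teamRel-restrict⁺ B R s₀ b {v} r =
    v ++ s₀ , (b v , subst R (sym (map-lookup-firstVars v s₀)) r) , map-lookup-firstVars v s₀

module _ {L : Signature} {A B : ℕ → Set} (options : ∀ {n} → A n → List (Formula L B n)) where

  instances : ∀ {n} → Formula L A n → List (Formula L B n)
  instances (eq t u)      = eq t u ∷ []
  instances (neq t u)     = neq t u ∷ []
  instances (relAt R ts)  = relAt R ts ∷ []
  instances (nrelAt R ts) = nrelAt R ts ∷ []
  instances (atom a)      = options a
  instances (and φ ψ)     = cartesianProductWith and (instances φ) (instances ψ)
  instances (or φ ψ)      = cartesianProductWith or (instances φ) (instances ψ)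
  instances (ex φ)        = mapᴸ ex (instances φ)
  instances (all φ)       = mapᴸ all (instances φ)

  module _ (𝔐 : Structure L) (S : AtomSem L A) (T : AtomSem L B) where
    private M = Dom 𝔐

    sat-instances⁻ : (∀ {n} (a : A n) {ψ} X → ψ ∈ options a → sat 𝔐 T X ψ → S 𝔐 a X) →
                     ∀ {n} (φ : Formula L A n) {φ′} X →
                     φ′ ∈ instances φ → sat 𝔐 T X φ′ → sat 𝔐 S X φ
    sat-instances⁻ h (eq t u)      X (here refl) p = p
    sat-instances⁻ h (neq t u)     X (here refl) p = p
    sat-instances⁻ h (relAt R ts)  X (here refl) p = p
    sat-instances⁻ h (nrelAt R ts) X (here refl) p = p
    sat-instances⁻ h (atom a)      X m           p = h a X m p
    sat-instances⁻ h (and φ ψ)     X m           p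
      with _ , _ , mφ , mψ , refl ← ∈-cartesianProductWith⁻ and (instances φ) (instances ψ) m =
      sat-instances⁻ h φ X mφ (proj₁ p) , sat-instances⁻ h ψ X mψ (proj₂ p)
    sat-instances⁻ h (or φ ψ)      X m           p
      with _ , _ , mφ , mψ , refl ← ∈-cartesianProductWith⁻ or (instances φ) (instances ψ) m =
      let Y , Z , cover , q , r = p in
      Y , Z , cover , sat-instances⁻ h φ Y mφ q , sat-instances⁻ h ψ Z mψ r
    sat-instances⁻ h (ex φ)        X m           p
      with _ , mφ , refl ← ∈-map⁻ ex m =
      let H , H-nonempty , q = p in H , H-nonempty , sat-instances⁻ h φ _ mφ q
    sat-instances⁻ h (all φ)       X m           p
      with _ , mφ , refl ← ∈-map⁻ all m =
      sat-instances⁻ h φ _ mφ p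

    sat-instances⁺ : (∀ {n} (a : A n) X → S 𝔐 a X → ∃ λ ψ → ψ ∈ options a × sat 𝔐 T X ψ) →
                     ∀ {n} (φ : Formula L A n) X →
                     sat 𝔐 S X φ → ∃ λ φ′ → φ′ ∈ instances φ × sat 𝔐 T X φ′
    sat-instances⁺ h (eq t u)      X p = _ , here refl , p
    sat-instances⁺ h (neq t u)     X p = _ , here refl , p
    sat-instances⁺ h (relAt R ts)  X p = _ , here refl , p
    sat-instances⁺ h (nrelAt R ts) X p = _ , here refl , p
    sat-instances⁺ h (atom a)      X p = h a X p
    sat-instances⁺ h (and φ ψ) X (p , q) =
      let φ′ , mφ , p′ = sat-instances⁺ h φ X p
          ψ′ , mψ , q′ = sat-instances⁺ h ψ X q
      in and φ′ ψ′ , ∈-cartesianProductWith⁺ and mφ mψ , p′ , q′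
    sat-instances⁺ h (or φ ψ) X (Y , Z , cover , p , q) =
      let φ′ , mφ , p′ = sat-instances⁺ h φ Y p
          ψ′ , mψ , q′ = sat-instances⁺ h ψ Z q
      in or φ′ ψ′ , ∈-cartesianProductWith⁺ or mφ mψ , Y , Z , cover , p′ , q′
    sat-instances⁺ h (ex φ) X (H , H-nonempty , p) =
      let φ′ , mφ , p′ = sat-instances⁺ h φ _ p in ex φ′ , ∈-map⁺ ex mφ , H , H-nonempty , p′
    sat-instances⁺ h (all φ) X p =
      let φ′ , mφ , p′ = sat-instances⁺ h φ _ p in all φ′ , ∈-map⁺ all mφ , p′

Translatable : ∀ {L A B} → AtomSem L A → AtomSem L B → Set₁
Translatable {L} {A} {B} S T =
  (φ : Sentence L A) → Σ (Sentence L B) λ ψ → ∀ (𝔐 : Structure L) → True 𝔐 S φ ⇔₁ True 𝔐 T ψ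

Translatable-trans : ∀ {L A B C} {S : AtomSem L A} {T : AtomSem L B} {U : AtomSem L C} →
                     Translatable S T → Translatable T U → Translatable S U
Translatable-trans S→T T→U φ =
  let ψ , φ⇔ψ = S→T φ
      χ , ψ⇔χ = T→U ψ
  in χ , λ 𝔐 → proj₁ (ψ⇔χ 𝔐) ∘ proj₁ (φ⇔ψ 𝔐) , proj₂ (φ⇔ψ 𝔐) ∘ proj₂ (ψ⇔χ 𝔐)

Translatable-fromFO : ∀ {L A B} {S : AtomSem L A} (T : AtomSem L B) →
                      Translatable S noSem → Translatable S T
Translatable-fromFO T S→FO φ =
  let ψ , φ⇔ψ = S→FO φ
  in fromFO ψ , λ 𝔐 → True-fromFO⁺ 𝔐 T ψ ∘ True-noSem⁻ 𝔐 ψ ∘ proj₁ (φ⇔ψ 𝔐) ,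
                      proj₂ (φ⇔ψ 𝔐) ∘ True-noSem⁺ 𝔐 ψ ∘ True-fromFO⁻ 𝔐 T ψ

record _DefinableIn_ {L : Signature} {A : ℕ → Set} (S↓ S : AtomSem L A) : Set₁ where
  field
    θ          : ∀ {n} → A n → Formula L A n
    γ          : Sentence L A
    θ-sound    : ∀ 𝔐 {n} (a : A n) X → sat 𝔐 S X (θ a) → S↓ 𝔐 a X
    θ-complete : ∀ 𝔐 {n} (a : A n) X → ∃ X → S↓ 𝔐 a X → sat 𝔐 S X (θ a)
    γ-sound    : ∀ 𝔐 → True 𝔐 S γ → ∀ {n} (a : A n) X → (∀ s → ¬ X s) → S↓ 𝔐 a X
    γ-complete : ∀ 𝔐 {n} (a : A n) X → (∀ s → ¬ X s) → S↓ 𝔐 a X → True 𝔐 S γ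

module _ (em : ∀ {ℓ} → ExcludedMiddle ℓ) {L : Signature} {A : ℕ → Set} {S↓ S : AtomSem L A}
         (S↓-definable : S↓ DefinableIn S) (S→FO : Translatable S noSem) where
  open _DefinableIn_ S↓-definable

  Options : Set
  Options = ∀ {n} → A n → List (Formula L A n)

  nonemptyCase emptyOrNot : Options
  nonemptyCase a = θ a ∷ []
  emptyOrNot   a = θ a ∷ fromFO falsum ∷ []

  private
    fo : Sentence L A → Sentence L NoAtom
    fo χ = proj₁ (S→FO χ)

    fo⁻ : ∀ 𝔐 χ → Holds 𝔐 [] (fo χ) → True 𝔐 S χ
    fo⁻ 𝔐 χ = proj₂ (proj₂ (S→FO χ) 𝔐) ∘ True-noSem⁺ 𝔐 (fo χ)

    fo⁺ : ∀ 𝔐 χ → True 𝔐 S χ → Holds 𝔐 [] (fo χ)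
    fo⁺ 𝔐 χ = True-noSem⁻ 𝔐 (fo χ) ∘ proj₁ (proj₂ (S→FO χ) 𝔐)

  elimination : Sentence L A → Sentence L NoAtom
  elimination φ = or (⋁ fo (instances nonemptyCase φ)) (and (fo γ) (⋁ fo (instances emptyOrNot φ)))

  module _ (𝔐 : Structure L) where

    Holds-⋁-fo⁻ : ∀ (options : Options) (φ : Sentence L A) → Holds 𝔐 [] (⋁ fo (instances options φ)) →
                  ∃ λ φ′ → φ′ ∈ instances options φ × True 𝔐 S φ′
    Holds-⋁-fo⁻ options φ p =
      let φ′ , m , q = find (Holds-⋁⁻ 𝔐 fo [] (instances options φ) p) in φ′ , m , fo⁻ 𝔐 φ′ q

    Holds-⋁-fo⁺ : ∀ (options : Options) (φ : Sentence L A) {φ′} →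
                  φ′ ∈ instances options φ → True 𝔐 S φ′ →
                  Holds 𝔐 [] (⋁ fo (instances options φ))
    Holds-⋁-fo⁺ options φ m p = Holds-⋁⁺ 𝔐 fo [] (lose m (fo⁺ 𝔐 _ p))

    nonemptyCase-sound : ∀ {n} (a : A n) {ψ} X → ψ ∈ nonemptyCase a → sat 𝔐 S X ψ → S↓ 𝔐 a X
    nonemptyCase-sound a X (here refl) = θ-sound 𝔐 a X

    emptyOrNot-sound : True 𝔐 S γ →
                       ∀ {n} (a : A n) {ψ} X → ψ ∈ emptyOrNot a → sat 𝔐 S X ψ → S↓ 𝔐 a X
    emptyOrNot-sound γ-true a X (here refl)         p = θ-sound 𝔐 a X p
    emptyOrNot-sound γ-true a X (there (here refl)) p =
      γ-sound 𝔐 γ-true a X λ s x → ¬Holds-falsum 𝔐 s (sat-fromFO⁻ 𝔐 S falsum X p s x)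

    nonemptyCase-complete : ¬ True 𝔐 S γ → ∀ {n} (a : A n) X → S↓ 𝔐 a X →
                            ∃ λ ψ → ψ ∈ nonemptyCase a × sat 𝔐 S X ψ
    nonemptyCase-complete γ-false a X p with em {P = ∃ X}
    ... | yes nonempty = θ a , here refl , θ-complete 𝔐 a X nonempty p
    ... | no  empty    = ⊥-elim (γ-false (γ-complete 𝔐 a X (λ s x → empty (s , x)) p))

    emptyOrNot-complete : ∀ {n} (a : A n) X → S↓ 𝔐 a X → ∃ λ ψ → ψ ∈ emptyOrNot a × sat 𝔐 S X ψ
    emptyOrNot-complete a X p with em {P = ∃ X}
    ... | yes nonempty = θ a , here refl , θ-complete 𝔐 a X nonempty p
    ... | no  empty    = fromFO falsum , there (here refl) ,
                         sat-fromFO⁺ 𝔐 S falsum X (λ s x → ⊥-elim (empty (s , x)))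

    elimination-sound : ∀ φ → Holds 𝔐 [] (elimination φ) → True 𝔐 S↓ φ
    elimination-sound φ (inj₁ p) =
      let φ′ , m , q = Holds-⋁-fo⁻ nonemptyCase φ p
      in sat-instances⁻ nonemptyCase 𝔐 S↓ S nonemptyCase-sound φ _ m q
    elimination-sound φ (inj₂ (γ-holds , p)) =
      let φ′ , m , q = Holds-⋁-fo⁻ emptyOrNot φ p
      in sat-instances⁻ emptyOrNot 𝔐 S↓ S (emptyOrNot-sound (fo⁻ 𝔐 γ γ-holds)) φ _ m q

    elimination-complete : ∀ φ → True 𝔐 S↓ φ → Holds 𝔐 [] (elimination φ)
    elimination-complete φ p with em {P = True 𝔐 S γ}
    ... | no γ-false =
      let φ′ , m , q = sat-instances⁺ nonemptyCase 𝔐 S↓ S (nonemptyCase-complete γ-false) φ _ p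
      in inj₁ (Holds-⋁-fo⁺ nonemptyCase φ m q)
    ... | yes γ-true =
      let φ′ , m , q = sat-instances⁺ emptyOrNot 𝔐 S↓ S emptyOrNot-complete φ _ p
      in inj₂ (fo⁺ 𝔐 γ γ-true , Holds-⋁-fo⁺ emptyOrNot φ m q)

  eliminate : Translatable S↓ noSem
  eliminate φ = elimination φ , λ 𝔐 →
    True-noSem⁺ 𝔐 (elimination φ) ∘ elimination-complete 𝔐 φ ,
    elimination-sound 𝔐 φ ∘ True-noSem⁻ 𝔐 (elimination φ)

resp-⇔ : ∀ {k} {D : Dep k} → IsoClosed D → {M : Set} {R R′ : Vec M k → Set} →
         (∀ w → R w → R′ w) → (∀ w → R′ w → R w) → D M R → D M R′
resp-⇔ D-iso {R = R} R⊆R′ R′⊆R =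
  D-iso ↔-refl _ _ (λ w r′ → subst R (sym (map-id w)) (R′⊆R w r′))
                   (λ w r → R⊆R′ w (subst R (map-id w) r))

inhabited : ∀ {L} k → Sentence L (DepAtom k)
inhabited k = allFirst k (or (atom (firstVars k 0)) (fromFO verum))

module _ (em : ∀ {ℓ} → ExcludedMiddle ℓ) {k : ℕ} (D : Dep k) (D-iso : IsoClosed D) {L : Signature} where

  ↓-θ : ∀ {n} → DepAtom k n → Formula L (DepAtom k) n
  ↓-θ {n} xs = allFirst k (or (fromFO (differ (firstVars k n) (map (k ↑ʳ_) xs))) (atom (firstVars k n)))

  module _ (𝔐 : Structure L) where
    private M = Dom 𝔐
    open Fresh {M} k

    depSem-restrict : ∀ {n} (B : Team M (k + n)) {R} (s₀ : Vec M n) → (∀ v → B (v ++ s₀)) → D M R →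
                      depSem D 𝔐 (firstVars k n) (λ t → B t × R (fresh t))
    depSem-restrict B {R} s₀ b =
      resp-⇔ D-iso (λ _ → teamRel-restrict⁺ B R s₀ b) (λ _ → teamRel-restrict⁻ B R)

    ↓-θ-sound : ∀ {n} (xs : DepAtom k n) X → sat 𝔐 (depSem D) X (↓-θ xs) → depSem (D ↓) 𝔐 xs X
    ↓-θ-sound {n} xs X p with subst id (sat-allFirst 𝔐 (depSem D) k X _) p
    ... | Z , Y , lift (cover , _ , _) , separated , d =
      teamRel Y (firstVars k n) , lift (λ v → teamRel-split xs (λ _ → ⊤) cover separated′ v tt) , d
      where
      separated′ : ∀ t → Z t → ⊤ → fresh t ≢ map (lookup t) (map (k ↑ʳ_) xs)
      separated′ t z _ = Holds-differ⁻ 𝔐 t _ _ (sat-fromFO⁻ 𝔐 (depSem D) _ Z separated t z)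

    ↓-θ-complete : ∀ {n} (xs : DepAtom k n) X → ∃ X → depSem (D ↓) 𝔐 xs X →
                   sat 𝔐 (depSem D) X (↓-θ xs)
    ↓-θ-complete {n} xs X (s₀ , x₀) (R , lift X⊆R , d) =
      subst id (sym (sat-allFirst 𝔐 (depSem D) k X _))
        (Z , Y , lift (cover , (λ _ → proj₁) , (λ _ → proj₁)) ,
         sat-fromFO⁺ 𝔐 (depSem D) _ Z separated ,
         depSem-restrict (λ t → X (dropFirst k t)) s₀ (λ v → subst X (sym (dropFirst-++ v s₀)) x₀) d)
      where
      Y Z : Team M (k + n)
      Y t = X (dropFirst k t) × R (fresh t)
      Z t = X (dropFirst k t) × ¬ R (fresh t)
      cover : ∀ t → X (dropFirst k t) → Z t ⊎ Y t
      cover t x with em {P = R (fresh t)}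
      ... | yes r = inj₂ (x , r)
      ... | no ¬r = inj₁ (x , ¬r)
      separated : ∀ t → Z t → Holds 𝔐 t (differ (firstVars k n) (map (k ↑ʳ_) xs))
      separated t (x , ¬r) = Holds-differ⁺ 𝔐 em t _ _ λ fresh≡xs →
        ¬r (subst R (sym fresh≡xs) (X⊆R _ (teamRel-dropFirst X xs t x)))

    ↓-γ-sound : True 𝔐 (depSem D) (inhabited k) →
                ∀ {n} (xs : DepAtom k n) X → (∀ s → ¬ X s) → depSem (D ↓) 𝔐 xs X
    ↓-γ-sound p xs X empty with subst id (sat-allFirst 𝔐 (depSem D) k _ _) p
    ... | Y , _ , _ , d , _ = teamRel Y (firstVars k 0) , lift (λ { v (s , x , _) → ⊥-elim (empty s x) }) , d

    ↓-γ-complete : ∀ {n} (xs : DepAtom k n) X → (∀ s → ¬ X s) → depSem (D ↓) 𝔐 xs X →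
                   True 𝔐 (depSem D) (inhabited k)
    ↓-γ-complete xs X _ (R , _ , d) =
      subst id (sym (sat-allFirst 𝔐 (depSem D) k _ _))
        (_ , (λ _ → ⊤) , lift ((λ _ _ → inj₂ tt) , (λ _ _ → tt) , (λ _ _ → tt)) ,
         depSem-restrict (λ _ → ⊤) [] (λ _ → tt) d ,
         sat-fromFO⁺ 𝔐 (depSem D) verum _ (λ s _ → Holds-verum 𝔐 s))

  ↓-definable : depSem (D ↓) DefinableIn depSem {L} D
  ↓-definable = record
    { θ = ↓-θ ; γ = inhabited k
    ; θ-sound = ↓-θ-sound ; θ-complete = ↓-θ-complete
    ; γ-sound = ↓-γ-sound ; γ-complete = ↓-γ-complete }

module _ {L : Signature} (𝔐 : Structure L) (P : Pred L) where
  private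
    M = Dom 𝔐
    Pᴹ = PSet 𝔐 P

  AllInP-proj₁ : ∀ {j} (w : Vec Pᴹ j) → AllInP 𝔐 P (map proj₁ w)
  AllInP-proj₁ w i = subst (InP 𝔐 P) (sym (lookup-map i proj₁ w)) (proj₂ (lookup w i))

  AllInP⇒map-proj₁ : ∀ {j} (v : Vec M j) → AllInP 𝔐 P v → ∃ λ (w : Vec Pᴹ j) → map proj₁ w ≡ v
  AllInP⇒map-proj₁ []      _   = [] , refl
  AllInP⇒map-proj₁ (a ∷ v) ∈P =
    let w , w≡v = AllInP⇒map-proj₁ v (∈P ∘ suc) in (a , ∈P zero) ∷ w , cong (a ∷_) w≡v

  map-proj₁-injective : ∀ {j} (w w′ : Vec Pᴹ j) → map proj₁ w ≡ map proj₁ w′ → w ≡ w′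
  map-proj₁-injective []            []              _ = refl
  map-proj₁-injective ((a , p) ∷ w) ((a′ , p′) ∷ w′) e with refl ← cong head e =
    cong₂ _∷_ (cong (a ,_) (Decidable⇒UIP.≡-irrelevant _≟_ p p′))
              (map-proj₁-injective w w′ (cong tail e))

  Image : ∀ {j} → (Vec Pᴹ j → Set) → Vec M j → Set
  Image R v = ∃ λ w → map proj₁ w ≡ v × R w

module _ (em : ∀ {ℓ} → ExcludedMiddle ℓ) {k : ℕ} (D : Dep k) (D-iso : IsoClosed D)
         {L : Signature} (P : Pred L) where

  ↓ᴾ-θ : ∀ {n} → DepAtom k n → Formula L (DepAtom k) n
  ↓ᴾ-θ {n} xs =
    and (fromFO (allIn P xs))
        (allFirst k (or (fromFO (or (differ ys (map (k ↑ʳ_) xs)) (someOutside P ys))) (atom ys)))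
    where ys = firstVars k n

  module _ (𝔐 : Structure L) where
    private
      M = Dom 𝔐
      Pᴹ = PSet 𝔐 P
    open Fresh {M} k

    relSem-restrict : ∀ {n} (B : Team M (k + n)) {R} (s₀ : Vec M n) → (∀ v → B (v ++ s₀)) → D Pᴹ R →
                      relSem D P 𝔐 (firstVars k n) (λ t → B t × Image 𝔐 P R (fresh t))
    relSem-restrict {n} B {R} s₀ b d =
      lift (λ { t (_ , w , w≡fresh , _) i →
                  subst (InP 𝔐 P) (trans (cong (λ v → lookup v i) w≡fresh) (lookup-map i (lookup t) ys))
                        (AllInP-proj₁ 𝔐 P w i) }) ,
      resp-⇔ D-iso (λ w r → teamRel-restrict⁺ B (Image 𝔐 P R) s₀ b (w , refl , r))
                   (λ w q → let w′ , w′≡w , r = teamRel-restrict⁻ B (Image 𝔐 P R) q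
                            in subst R (map-proj₁-injective 𝔐 P w′ w w′≡w) r) d
      where ys = firstVars k n

    ↓ᴾ-θ-sound : ∀ {n} (xs : DepAtom k n) X → sat 𝔐 (relSem D P) X (↓ᴾ-θ xs) → relSem (D ↓) P 𝔐 xs X
    ↓ᴾ-θ-sound {n} xs X (xs∈P , p) with subst id (sat-allFirst 𝔐 (relSem D P) k X _) p
    ... | Z , Y , lift (cover , _ , _) , separated , (_ , d) =
      lift (λ s x → Holds-allIn⁻ 𝔐 P s xs (sat-fromFO⁻ 𝔐 (relSem D P) (allIn P xs) X xs∈P s x)) ,
      (λ w → teamRel Y ys (map proj₁ w)) ,
      lift (λ w → teamRel-split xs (AllInP 𝔐 P) cover separated′ (map proj₁ w) (AllInP-proj₁ 𝔐 P w)) , d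
      where
      ys = firstVars k n
      separated′ : ∀ t → Z t → AllInP 𝔐 P (fresh t) → fresh t ≢ map (lookup t) (map (k ↑ʳ_) xs)
      separated′ t z ∈P
        with sat-fromFO⁻ 𝔐 (relSem D P) (or (differ ys (map (k ↑ʳ_) xs)) (someOutside P ys)) Z separated t z
      ... | inj₁ differs = Holds-differ⁻ 𝔐 t _ _ differs
      ... | inj₂ outside = ⊥-elim (Holds-someOutside⁻ 𝔐 P t ys outside ∈P)

    ↓ᴾ-θ-complete : ∀ {n} (xs : DepAtom k n) X → ∃ X → relSem (D ↓) P 𝔐 xs X →
                    sat 𝔐 (relSem D P) X (↓ᴾ-θ xs)
    ↓ᴾ-θ-complete {n} xs X (s₀ , x₀) (lift xs∈P , R , lift X⊆R , d) =
      sat-fromFO⁺ 𝔐 (relSem D P) (allIn P xs) X (λ s x → Holds-allIn⁺ 𝔐 P s xs (xs∈P s x)) ,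
      subst id (sym (sat-allFirst 𝔐 (relSem D P) k X _))
        (Z , Y , lift (cover , (λ _ → proj₁) , (λ _ → proj₁)) ,
         sat-fromFO⁺ 𝔐 (relSem D P) _ Z separated ,
         relSem-restrict (λ t → X (dropFirst k t)) s₀ (λ v → subst X (sym (dropFirst-++ v s₀)) x₀) d)
      where
      ys = firstVars k n
      Y Z : Team M (k + n)
      Y t = X (dropFirst k t) × Image 𝔐 P R (fresh t)
      Z t = X (dropFirst k t) × ¬ Image 𝔐 P R (fresh t)
      cover : ∀ t → X (dropFirst k t) → Z t ⊎ Y t
      cover t x with em {P = Image 𝔐 P R (fresh t)}
      ... | yes r = inj₂ (x , r)
      ... | no ¬r = inj₁ (x , ¬r)
      separated : ∀ t → Z t → Holds 𝔐 t (or (differ ys (map (k ↑ʳ_) xs)) (someOutside P ys))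
      separated t (x , ¬r) with em {P = AllInP 𝔐 P (fresh t)}
      ... | no  outside = inj₂ (Holds-someOutside⁺ 𝔐 em P t ys outside)
      ... | yes ∈P      = inj₁ (Holds-differ⁺ 𝔐 em t _ _ λ fresh≡xs →
        let w , w≡fresh = AllInP⇒map-proj₁ 𝔐 P (fresh t) ∈P
        in ¬r (w , w≡fresh , X⊆R w (subst (teamRel X xs) (sym (trans w≡fresh fresh≡xs))
                                           (teamRel-dropFirst X xs t x))))

    ↓ᴾ-γ-sound : True 𝔐 (relSem D P) (inhabited k) →
                 ∀ {n} (xs : DepAtom k n) X → (∀ s → ¬ X s) → relSem (D ↓) P 𝔐 xs X
    ↓ᴾ-γ-sound p xs X empty with subst id (sat-allFirst 𝔐 (relSem D P) k _ _) p
    ... | Y , _ , _ , (_ , d) , _ =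
      lift (λ s x → ⊥-elim (empty s x)) , (λ w → teamRel Y (firstVars k 0) (map proj₁ w)) ,
      lift (λ { w (s , x , _) → ⊥-elim (empty s x) }) , d

    ↓ᴾ-γ-complete : ∀ {n} (xs : DepAtom k n) X → (∀ s → ¬ X s) → relSem (D ↓) P 𝔐 xs X →
                    True 𝔐 (relSem D P) (inhabited k)
    ↓ᴾ-γ-complete xs X _ (_ , R , _ , d) =
      subst id (sym (sat-allFirst 𝔐 (relSem D P) k _ _))
        (_ , (λ _ → ⊤) , lift ((λ _ _ → inj₂ tt) , (λ _ _ → tt) , (λ _ _ → tt)) ,
         relSem-restrict (λ _ → ⊤) [] (λ _ → tt) d ,
         sat-fromFO⁺ 𝔐 (relSem D P) verum _ (λ s _ → Holds-verum 𝔐 s))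

  ↓ᴾ-definable : relSem (D ↓) P DefinableIn relSem D P
  ↓ᴾ-definable = record
    { θ = ↓ᴾ-θ ; γ = inhabited k
    ; θ-sound = ↓ᴾ-θ-sound ; θ-complete = ↓ᴾ-θ-complete
    ; γ-sound = ↓ᴾ-γ-sound ; γ-complete = ↓ᴾ-γ-complete }

lemma2 : (∀ {ℓ} → ExcludedMiddle ℓ) →
         ∀ (k : ℕ) (D : Dep k) → IsoClosed D →
         StronglyFirstOrder D →
         StronglyFirstOrder (D ↓) × (Relativizable D → Relativizable (D ↓))
lemma2 em k D D-iso D-sfo = D↓-sfo , D↓-relativizable
  where
  D↓-sfo : StronglyFirstOrder (D ↓)
  D↓-sfo L = eliminate em (↓-definable em D D-iso) (D-sfo L)

  D↓-relativizable : Relativizable D → Relativizable (D ↓)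
  D↓-relativizable D-rel L P P-unary =
    Translatable-fromFO (depSem (D ↓))
      (eliminate em (↓ᴾ-definable em D D-iso P) (Translatable-trans (D-rel L P P-unary) (D-sfo L)))
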